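{- Let $u$ be even, $u\geq 8$, with $u\equiv 0,1,3,4,5,7,8,9,11\pmod{12}$. Then the graph $\langle \mathbb Z_u\cup\{\infty_1,\infty_2,\infty_3\},\{1,\frac u2\}\rangle$ can be decomposed into $3$-suns.
   Context: A $3$-sun is the graph on six vertices $a,b,c,d,e,f$ with edges $\{a,b\},\{b,c\},\{c,a\},\{a,d\},\{b,e\},\{c,f\}$; a decomposition of a graph into $3$-suns is a partition of its edge set into subgraphs isomorphic to a $3$-sun. For a positive integer $u$, $\mathbb Z_u=\{0,1,\dots,u-1\}$ (integers mod $u$), and for distinct $i,j\in\mathbb Z_u$, $|i-j|_u=\min\{|i-j|,u-|i-j|\}$. For a set $H$ disjoint from $\mathbb Z_u$ and a nonempty set $D\subseteq\{1,\dots,\lfloor u/2\rfloor\}$, $\langle \mathbb Z_u\cup H,D\rangle$ is the graph with vertex set $\mathbb Z_u\cup H$ and edge set $\{\{i,j\}: i,j\in\mathbb Z_u,\ |i-j|_u\in D\}\cup\{\{\infty,i\}:\infty\in H,\ i\in\mathbb Z_u\}$ (for $d=u/2$ this contributes the perfect matching $\{\{i,i+u/2\}\}$). -}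

module Defs where

open import Data.Nat using (ℕ; zero; suc; _∸_; _⊓_; ∣_-_∣)
open import Data.Fin using (Fin; toℕ) renaming (zero to f0; suc to fs)
open import Data.Fin.Properties using () renaming (_≟_ to _≟ᶠ_)
open import Data.Sum using (_⊎_; inj₁; inj₂)
open import Data.Sum.Properties using (≡-dec)
open import Data.Product using (_×_; _,_)
open import Data.List using (List; []; _∷_; concatMap)
import Data.List.Membership.Propositional
open import Data.Unit using (⊤)
open import Data.Empty using (⊥)
open import Relation.Nullary using (¬_; Dec; yes; no)
open import Relation.Nullary.Decidable using (_×-dec_; _⊎-dec_)
open import Relation.Binary.PropositionalEquality using (_≡_; _≢_)

-- Vertex set Z_u ∪ H with |H| = h: inj₁ i is i ∈ Z_u, inj₂ k is ∞_{k+1}.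
V : ℕ → ℕ → Set
V u h = Fin u ⊎ Fin h

_≟V_ : ∀ {u h} → (x y : V u h) → Dec (x ≡ y)
_≟V_ = ≡-dec _≟ᶠ_ _≟ᶠ_

distZ : (u : ℕ) → Fin u → Fin u → ℕ
distZ u i j = ∣ toℕ i - toℕ j ∣ ⊓ (u ∸ ∣ toℕ i - toℕ j ∣)

Adj : (u h : ℕ) → (D : ℕ → Set) → V u h → V u h → Set
Adj u h D (inj₁ i) (inj₁ j) = i ≢ j × D (distZ u i j)
Adj u h D (inj₁ i) (inj₂ k) = ⊤
Adj u h D (inj₂ k) (inj₁ i) = ⊤
Adj u h D (inj₂ k) (inj₂ l) = ⊥

record Sun (A : Set) : Set where
  field
    vtx : Fin 6 → A
    inj : ∀ i j → vtx i ≡ vtx j → i ≡ j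

  a b c d e f : A
  a = vtx f0
  b = vtx (fs f0)
  c = vtx (fs (fs f0))
  d = vtx (fs (fs (fs f0)))
  e = vtx (fs (fs (fs (fs f0))))
  f = vtx (fs (fs (fs (fs (fs f0)))))

  edges : List (A × A)
  edges = (a , b) ∷ (b , c) ∷ (c , a) ∷ (a , d) ∷ (b , e) ∷ (c , f) ∷ []

SameEdge : {A : Set} → A → A → A × A → Set
SameEdge x y (p , q) = (x ≡ p × y ≡ q) ⊎ (x ≡ q × y ≡ p)

countEdge : ∀ {u h} → V u h → V u h → List (V u h × V u h) → ℕ
countEdge x y [] = zero
countEdge x y ((p , q) ∷ es) with ((x ≟V p) ×-dec (y ≟V q)) ⊎-dec ((x ≟V q) ×-dec (y ≟V p))
... | yes _ = suc (countEdge x y es)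
... | no  _ = countEdge x y es

allEdges : {A : Set} → List (Sun A) → List (A × A)
allEdges = concatMap Sun.edges

record SunDecomposition (u h : ℕ) (D : ℕ → Set) : Set where
  field
    suns     : List (Sun (V u h))
    sound    : ∀ s → s Data.List.Membership.Propositional.∈ suns → ∀ x y → (x , y) Data.List.Membership.Propositional.∈ Sun.edges s → Adj u h D x y
    exactly1 : ∀ x y → Adj u h D x y → countEdge x y (allEdges suns) ≡ 1

-- With u = 2n, the circulant ⟨ℤ_u, {1, n}⟩ is a Möbius ladder whose columns are
-- the pairs {j, n + j}. Together with the spokes to ∞₁, ∞₂, ∞₃, column j < n
-- carries nine edges: the two rails towards column j + 1, the rung {j, n + j}
-- and six spokes. Numbering them 9j + k enumerates the 9n edges bijectively; the
-- inverse numbering is read off the endpoints (index).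
-- A block of width w is a list of 3-suns drawn on w consecutive columns whose
-- edges receive every number below 9w exactly once; one block of width 4 and one
-- of width 6 are checked by evaluation. As 4 ∣ u, n is 4k or 6 + 4k, so blocks
-- laid side by side go exactly once around the ladder, and since every sun spans
-- fewer than n columns it stays a 3-sun after reduction modulo u.

module Submission where

open import Defs
open import Data.Bool using (Bool; true; false; not; if_then_else_)
import Data.Bool.Properties as Bool
open import Data.Fin using (Fin; zero; suc; toℕ; fromℕ<)
import Data.Fin.Properties as Fin
open import Data.List using (List; []; _∷_; _++_; map; applyUpTo; upTo)
open import Data.List.Properties using (≡-dec; map-++; concatMap-++; map-∘; map-upTo)
open import Data.List.Membership.Propositional using (_∈_; _∉_)
open import Data.List.Membership.Propositional.Properties
  using (∈-upTo⁺; ∈-upTo⁻; ∈-map⁺; ∈-concat⁺′)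
open import Data.List.Relation.Unary.Any using (here; there)
open import Data.List.Relation.Unary.All as All using (All; []; _∷_; all?)
open import Data.List.Relation.Unary.Unique.Propositional using (Unique; _∷_)
import Data.List.Relation.Unary.Unique.Propositional.Properties as Unique
open import Data.List.Relation.Binary.Pointwise as Pointwise using (Pointwise; []; _∷_)
open import Data.List.Relation.Binary.Permutation.Propositional
  using (_↭_; ↭-sym; ↭-trans; ↭-reflexive; ↭⇒↭ₛ)
import Data.List.Relation.Binary.Permutation.Propositional.Properties as Perm
import Data.List.Relation.Binary.Permutation.Setoid.Properties as PermₛProps
open import Data.Nat
open import Data.Nat.Properties
open import Data.List.Sort.InsertionSort ≤-decTotalOrder using (sort)
open import Data.List.Sort.InsertionSort.Properties ≤-decTotalOrder using (sort-↭)
open import Data.Nat.DivMod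
open import Data.Nat.Tactic.RingSolver using (solve-∀)
open import Data.Nat.Divisibility
  using (_∣_; _∣?_; divides; divides-refl; n∣m⇒m%n≡0; ∣m∣n⇒∣m+n; ∣-trans; n∣m*n)
open import Data.Product using (∃-syntax; _×_; _,_; proj₁; proj₂; swap; uncurry)
import Data.Product as Product
import Data.Product.Properties as Product
open import Data.Sum using (_⊎_; inj₁; inj₂)
import Data.Sum.Properties as Sum
open import Data.Vec using ([]; _∷_; lookup)
open import Function using (_∘_; _⇔_; mk⇔; Equivalence)
open import Relation.Binary.Definitions using (DecidableEquality)
open import Relation.Binary.PropositionalEquality
open import Relation.Nullary using (Dec; yes; no; does; ¬_; contradiction)
open import Relation.Nullary.Decidable
  using (True; toWitness; from-yes; map′; dec-true; dec-false; _×-dec_; _⊎-dec_; _→-dec_)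

private
  variable
    A B : Set

Orient : A × A → A × A → Set
Orient e e′ = e ≡ e′ ⊎ e ≡ swap e′

orient-map : (f : A → B) {e e′ : A × A} →
             Orient e e′ → Orient (Product.map f f e) (Product.map f f e′)
orient-map f (inj₁ refl) = inj₁ refl
orient-map f (inj₂ refl) = inj₂ refl

sameEdge-swap : {x y : A} {e : A × A} → SameEdge x y e → SameEdge y x e
sameEdge-swap (inj₁ (x≡p , y≡q)) = inj₂ (y≡q , x≡p)
sameEdge-swap (inj₂ (x≡q , y≡p)) = inj₁ (y≡p , x≡q)

sameEdge-flip : {x y : A} {e : A × A} → SameEdge x y (swap e) → SameEdge x y e
sameEdge-flip (inj₁ (x≡q , y≡p)) = inj₂ (x≡q , y≡p)
sameEdge-flip (inj₂ (x≡p , y≡q)) = inj₁ (x≡p , y≡q)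

sameEdge-orientʳ : {x y : A} {e e′ : A × A} → Orient e e′ → SameEdge x y e → SameEdge x y e′
sameEdge-orientʳ (inj₁ refl) se = se
sameEdge-orientʳ {e′ = (p , q)} (inj₂ refl) se = sameEdge-flip se

sameEdge-orientˡ : {x y : A} {e e′ : A × A} → Orient e e′ → SameEdge x y e′ → SameEdge x y e
sameEdge-orientˡ (inj₁ refl) se = se
sameEdge-orientˡ {e′ = (p , q)} (inj₂ refl) se = sameEdge-flip se

module _ {u h : ℕ} {R : V u h × V u h → ℕ → Set} {P : ℕ → Set} (x y : V u h) {d₀ : ℕ}
         (matches : ∀ {e d} → P d → R e d → SameEdge x y e ⇔ d ≡ d₀) where

  open Equivalence

  countEdge-≡0 : ∀ {es ds} → Pointwise R es ds → All P ds → d₀ ∉ ds → countEdge x y es ≡ 0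
  countEdge-≡0 [] [] _ = refl
  countEdge-≡0 {(p , q) ∷ _} (r ∷ rs) (pd ∷ pds) d₀∉
    with ((x ≟V p) ×-dec (y ≟V q)) ⊎-dec ((x ≟V q) ×-dec (y ≟V p))
  ... | yes xy≈pq = contradiction (here (sym (to (matches pd r) xy≈pq))) d₀∉
  ... | no _      = countEdge-≡0 rs pds (d₀∉ ∘ there)

  countEdge-≡1 : ∀ {es ds} → Pointwise R es ds → All P ds → Unique ds → d₀ ∈ ds →
                 countEdge x y es ≡ 1
  countEdge-≡1 {(p , q) ∷ _} (r ∷ rs) (pd ∷ pds) (d∉ds ∷ unique) d₀∈
    with ((x ≟V p) ×-dec (y ≟V q)) ⊎-dec ((x ≟V q) ×-dec (y ≟V p))
  ... | yes xy≈pq = cong suc (countEdge-≡0 rs pds λ d₀∈ds →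
      All.lookup d∉ds (subst (_∈ _) (sym (to (matches pd r) xy≈pq)) d₀∈ds) refl)
  ... | no xy≉pq with d₀∈
  ...   | here d₀≡d   = contradiction (from (matches pd r) (sym d₀≡d)) xy≉pq
  ...   | there d₀∈ds = countEdge-≡1 rs pds unique d₀∈ds

Pointwise-∈ : {R : A → B → Set} {xs : List A} {ys : List B} {x : A} →
              Pointwise R xs ys → x ∈ xs → ∃[ y ] y ∈ ys × R x y
Pointwise-∈ (r ∷ _) (here refl) = _ , here refl , r
Pointwise-∈ (_ ∷ rs) (there x∈) with Pointwise-∈ rs x∈
... | y , y∈ , r = y , there y∈ , r

All⇒Pointwise-map : {C : Set} {R : A → B → Set} {P : C → Set} (f : C → A) (g : C → B) →
                    (∀ {c} → P c → R (f c) (g c)) →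
                    ∀ {cs} → All P cs → Pointwise R (map f cs) (map g cs)
All⇒Pointwise-map f g r [] = []
All⇒Pointwise-map f g r (p ∷ ps) = r p ∷ All⇒Pointwise-map f g r ps

applyUpTo-+ : ∀ (f : ℕ → A) m n → applyUpTo f (m + n) ≡ applyUpTo f m ++ applyUpTo (f ∘ (m +_)) n
applyUpTo-+ f zero n = refl
applyUpTo-+ f (suc m) n = cong (f 0 ∷_) (applyUpTo-+ (f ∘ suc) m n)

applyUpTo-cong : ∀ {f g : ℕ → A} → (∀ i → f i ≡ g i) → ∀ n → applyUpTo f n ≡ applyUpTo g n
applyUpTo-cong f≗g zero = refl
applyUpTo-cong f≗g (suc n) = cong₂ _∷_ (f≗g 0) (applyUpTo-cong (f≗g ∘ suc) n)

↭-upTo⇒Unique : ∀ {ds n} → ds ↭ upTo n → Unique ds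
↭-upTo⇒Unique {n = n} p =
  PermₛProps.Unique-resp-↭ (setoid ℕ) (↭⇒↭ₛ (↭-sym p)) (Unique.upTo⁺ n)

[m*n+o]/n≡m : ∀ m n o .{{_ : NonZero n}} → o < n → (m * n + o) / n ≡ m
[m*n+o]/n≡m m n o o<n = begin
  (m * n + o) / n       ≡⟨ cong (_/ n) (+-comm (m * n) o) ⟩
  (o + m * n) / n       ≡⟨ +-distrib-/-∣ʳ o (divides-refl m) ⟩
  o / n + m * n / n     ≡⟨ cong₂ _+_ (m<n⇒m/n≡0 o<n) (m*n/n≡m m n) ⟩
  m                     ∎
  where open ≡-Reasoning

[m*n+o]%n≡o : ∀ m n o .{{_ : NonZero n}} → o < n → (m * n + o) % n ≡ o
[m*n+o]%n≡o m n o o<n = begin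
  (m * n + o) % n       ≡⟨ cong (_% n) (+-comm (m * n) o) ⟩
  (o + m * n) % n       ≡⟨ [m+kn]%n≡m%n o m n ⟩
  o % n                 ≡⟨ m<n⇒m%n≡m o<n ⟩
  o                     ∎
  where open ≡-Reasoning

r≢[r+o]%n : ∀ {r n o} .{{_ : NonZero n}} → r < n → 0 < o → o < n → r ≢ (r + o) % n
r≢[r+o]%n {r} {n} {o} r<n 0<o o<n eq with r + o <? n
... | yes r+o<n = <⇒≢ (m<m+n r 0<o) (trans eq (m<n⇒m%n≡m r+o<n))
... | no r+o≮n = <⇒≢ o<n (sym (+-cancelˡ-≡ r n o (begin
  r + n                 ≡⟨ cong (_+ n) eq ⟩
  (r + o) % n + n       ≡⟨ cong (_+ n) (m≤n⇒[n∸m]%m≡n%m n≤r+o) ⟨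
  (r + o ∸ n) % n + n   ≡⟨ cong (_+ n) (m<n⇒m%n≡m r+o∸n<n) ⟩
  r + o ∸ n + n         ≡⟨ m∸n+n≡m n≤r+o ⟩
  r + o                 ∎)))
  where
  open ≡-Reasoning
  n≤r+o : n ≤ r + o
  n≤r+o = ≮⇒≥ r+o≮n
  r+o∸n<n : r + o ∸ n < n
  r+o∸n<n = subst (r + o ∸ n <_) (m+n∸n≡m n n) (∸-monoˡ-< (+-mono-< r<n o<n) n≤r+o)

m%n≢[m+o]%n : ∀ m {n o} .{{_ : NonZero n}} → 0 < o → o < n → m % n ≢ (m + o) % n
m%n≢[m+o]%n m {n} {o} 0<o o<n eq = r≢[r+o]%n (m%n<n m n) 0<o o<n (begin
  m % n                 ≡⟨ eq ⟩
  (m + o) % n           ≡⟨ %-distribˡ-+ m o n ⟩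
  (m % n + o % n) % n   ≡⟨ cong (λ z → (m % n + z) % n) (m<n⇒m%n≡m o<n) ⟩
  (m % n + o) % n       ∎)
  where open ≡-Reasoning

-- pt false j and pt true j stand for j and n + j, the two vertices of column j,
-- and ∞ q for ∞_{q+1}; points do not depend on n, so blocks are checked once for all n.
data Point : Set where
  ∞  : Fin 3 → Point
  pt : Bool → ℕ → Point

pattern ∞₁ = ∞ zero
pattern ∞₂ = ∞ (suc zero)
pattern ∞₃ = ∞ (suc (suc zero))

pt-injective : ∀ {s s′ j j′} → pt s j ≡ pt s′ j′ → s ≡ s′ × j ≡ j′
pt-injective refl = refl , refl

_≟ₚ_ : DecidableEquality Point
∞ q ≟ₚ ∞ q′ = map′ (cong ∞) (λ { refl → refl }) (q Fin.≟ q′)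
∞ _ ≟ₚ pt _ _ = no λ ()
pt _ _ ≟ₚ ∞ _ = no λ ()
pt s j ≟ₚ pt s′ j′ =
  map′ (λ (s≡s′ , j≡j′) → cong₂ pt s≡s′ j≡j′) pt-injective
       ((s Bool.≟ s′) ×-dec (j ≟ j′))

sideCode : Bool → ℕ
sideCode false = 0
sideCode true  = 1

-- Kind 8 and every larger kind give the last spoke; only kinds below 9 are used.
edgeAt : ℕ → ℕ → Point × Point
edgeAt j 0 = pt false j , pt false (suc j)
edgeAt j 1 = pt true j , pt true (suc j)
edgeAt j 2 = pt false j , pt true j
edgeAt j 3 = ∞₁ , pt false j
edgeAt j 4 = ∞₁ , pt true j
edgeAt j 5 = ∞₂ , pt false j
edgeAt j 6 = ∞₂ , pt true j
edgeAt j 7 = ∞₃ , pt false j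
edgeAt j _ = ∞₃ , pt true j

spokeKind : Fin 3 → Bool → ℕ
spokeKind q s = 3 + (2 * toℕ q + sideCode s)

edgeAt-spokeKind : ∀ j q s → edgeAt j (spokeKind q s) ≡ (∞ q , pt s j)
edgeAt-spokeKind j zero false = refl
edgeAt-spokeKind j zero true  = refl
edgeAt-spokeKind j (suc zero) false = refl
edgeAt-spokeKind j (suc zero) true  = refl
edgeAt-spokeKind j (suc (suc zero)) false = refl
edgeAt-spokeKind j (suc (suc zero)) true  = refl

ladderEdge : ℕ → Point × Point
ladderEdge d = edgeAt (d / 9) (d % 9)

-- Two points on different sides and in different columns are joined only by a rail
-- crossing the seam from column n − 1 to column 0, numbered from its endpoint in column n − 1.
edgeCode : Point × Point → ℕ
edgeCode (∞ q , pt s j) = 9 * j + spokeKind q s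
edgeCode (pt s j , ∞ q) = 9 * j + spokeKind q s
edgeCode (∞ _ , ∞ _) = 0
edgeCode (pt s j , pt s′ j′) =
  if does (s Bool.≟ s′) then 9 * (j ⊓ j′) + sideCode s
  else if does (j ≟ j′) then 9 * j + 2
  else if does (j <? j′) then 9 * j′ + sideCode s′ else 9 * j + sideCode s

shift : ℕ → Point → Point
shift c (∞ q) = ∞ q
shift c (pt s j) = pt s (c + j)

shiftPair : ℕ → Point × Point → Point × Point
shiftPair c = Product.map (shift c) (shift c)

gap : Point → Point → ℕ
gap (pt _ j) (pt _ j′) = ∣ j - j′ ∣
gap _ _ = 0

sideCode≤1 : ∀ s → sideCode s ≤ 1
sideCode≤1 false = z≤n
sideCode≤1 true  = ≤-refl

spokeKind<9 : ∀ q s → spokeKind q s < 9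
spokeKind<9 q s = s≤s (+-monoʳ-≤ 3 (+-mono-≤ (*-monoʳ-≤ 2 (Fin.toℕ≤pred[n] q)) (sideCode≤1 s)))

9*[d/9]+d%9≡d : ∀ d → 9 * (d / 9) + d % 9 ≡ d
9*[d/9]+d%9≡d d = begin
  9 * (d / 9) + d % 9   ≡⟨ +-comm (9 * (d / 9)) (d % 9) ⟩
  d % 9 + 9 * (d / 9)   ≡⟨ cong (d % 9 +_) (*-comm 9 (d / 9)) ⟩
  d % 9 + d / 9 * 9     ≡⟨ m≡m%n+[m/n]*n d 9 ⟨
  d                     ∎
  where open ≡-Reasoning

ladderEdge-9*+ : ∀ j k → k < 9 → ladderEdge (9 * j + k) ≡ edgeAt j k
ladderEdge-9*+ j k k<9 rewrite *-comm 9 j = cong₂ edgeAt ([m*n+o]/n≡m j 9 k k<9) ([m*n+o]%n≡o j 9 k k<9)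

shift-edgeAt : ∀ c j k → shiftPair c (edgeAt j k) ≡ edgeAt (c + j) k
shift-edgeAt c j 0 rewrite +-suc c j = refl
shift-edgeAt c j 1 rewrite +-suc c j = refl
shift-edgeAt c j 2 = refl
shift-edgeAt c j 3 = refl
shift-edgeAt c j 4 = refl
shift-edgeAt c j 5 = refl
shift-edgeAt c j 6 = refl
shift-edgeAt c j 7 = refl
shift-edgeAt c j (suc (suc (suc (suc (suc (suc (suc (suc _)))))))) = refl

shift-ladderEdge : ∀ c d → shiftPair c (ladderEdge d) ≡ ladderEdge (9 * c + d)
shift-ladderEdge c d = begin
  shiftPair c (edgeAt (d / 9) (d % 9))       ≡⟨ shift-edgeAt c (d / 9) (d % 9) ⟩
  edgeAt (c + d / 9) (d % 9)                 ≡⟨ ladderEdge-9*+ (c + d / 9) (d % 9) (m%n<n d 9) ⟨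
  ladderEdge (9 * (c + d / 9) + d % 9)       ≡⟨ cong (λ m → ladderEdge (m + d % 9)) (*-distribˡ-+ 9 c (d / 9)) ⟩
  ladderEdge (9 * c + 9 * (d / 9) + d % 9)   ≡⟨ cong ladderEdge (+-assoc (9 * c) (9 * (d / 9)) (d % 9)) ⟩
  ladderEdge (9 * c + (9 * (d / 9) + d % 9)) ≡⟨ cong (λ m → ladderEdge (9 * c + m)) (9*[d/9]+d%9≡d d) ⟩
  ladderEdge (9 * c + d)                     ∎
  where open ≡-Reasoning

gap-shift : ∀ c a b → gap (shift c a) (shift c b) ≡ gap a b
gap-shift c (∞ _) (∞ _) = refl
gap-shift c (∞ _) (pt _ _) = refl
gap-shift c (pt _ _) (∞ _) = refl
gap-shift c (pt _ j) (pt _ j′) = ∣m+n-m+o∣≡∣n-o∣ c j j′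

shift-injective : ∀ c {a b} → shift c a ≡ shift c b → a ≡ b
shift-injective c {∞ _} {∞ _} refl = refl
shift-injective c {pt s j} {pt s′ j′} eq with refl , c+j≡c+j′ ← pt-injective eq =
  cong (pt s) (+-cancelˡ-≡ c j j′ c+j≡c+j′)

edgeCode-sameSide : ∀ s j j′ → edgeCode (pt s j , pt s j′) ≡ 9 * (j ⊓ j′) + sideCode s
edgeCode-sameSide false j j′ = refl
edgeCode-sameSide true  j j′ = refl

edgeCode-rail : ∀ s j → edgeCode (pt s j , pt s (suc j)) ≡ 9 * j + sideCode s
edgeCode-rail s j =
  trans (edgeCode-sameSide s j (suc j)) (cong (λ m → 9 * m + sideCode s) (m≤n⇒m⊓n≡m (n≤1+n j)))

edgeCode-rail′ : ∀ s j → edgeCode (pt s (suc j) , pt s j) ≡ 9 * j + sideCode s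
edgeCode-rail′ s j =
  trans (edgeCode-sameSide s (suc j) j) (cong (λ m → 9 * m + sideCode s) (m≥n⇒m⊓n≡n (n≤1+n j)))

edgeCode-seam : ∀ s {j} → 0 < j → edgeCode (pt s j , pt (not s) 0) ≡ 9 * j + sideCode s
edgeCode-seam false {suc j} _ = refl
edgeCode-seam true  {suc j} _ = refl

edgeCode-seam′ : ∀ s {j} → 0 < j → edgeCode (pt (not s) 0 , pt s j) ≡ 9 * j + sideCode s
edgeCode-seam′ false {suc j} _ = refl
edgeCode-seam′ true  {suc j} _ = refl

edgeCode-rung : ∀ j → edgeCode (pt false j , pt true j) ≡ 9 * j + 2
edgeCode-rung j rewrite dec-true (j ≟ j) refl = refl

edgeCode-rung′ : ∀ j → edgeCode (pt true j , pt false j) ≡ 9 * j + 2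
edgeCode-rung′ j rewrite dec-true (j ≟ j) refl = refl

Injective₆ : (Fin 6 → A) → Set
Injective₆ f = ∀ i j → f i ≡ f j → i ≡ j

injective? : (f : Fin 6 → Point) → Dec (Injective₆ f)
injective? f = Fin.all? λ i → Fin.all? λ j → (f i ≟ₚ f j) →-dec (i Fin.≟ j)

sun : (a b c d e f : Point) → {True (injective? (lookup (a ∷ b ∷ c ∷ d ∷ e ∷ f ∷ [])))} →
      Sun Point
sun a b c d e f {inj} = record { vtx = lookup (a ∷ b ∷ c ∷ d ∷ e ∷ f ∷ []) ; inj = toWitness inj }

-- Narrowness keeps a sun injective once placed: pt s j and pt (not s) (n + j) are the same vertex.
Narrow : ℕ → Sun Point → Set
Narrow w s = ∀ i j → gap (Sun.vtx s i) (Sun.vtx s j) < w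

narrow? : ∀ w s → Dec (Narrow w s)
narrow? w s = Fin.all? λ i → Fin.all? λ j → gap (Sun.vtx s i) (Sun.vtx s j) <? w

narrow-≤ : ∀ {w w′} → w ≤ w′ → ∀ {s} → Narrow w s → Narrow w′ s
narrow-≤ w≤w′ narrow i j = <-≤-trans (narrow i j) w≤w′

Labelled : Point × Point → Set
Labelled e = Orient e (ladderEdge (edgeCode e))

labelled? : ∀ e → Dec (Labelled e)
labelled? e = (e ≟ₑ ladderEdge (edgeCode e)) ⊎-dec (e ≟ₑ swap (ladderEdge (edgeCode e)))
  where
  _≟ₑ_ : DecidableEquality (Point × Point)
  _≟ₑ_ = Product.≡-dec _≟ₚ_ _≟ₚ_

record Block : Set where
  field
    width    : ℕ
    suns     : List (Sun Point)
    narrow   : All (Narrow width) suns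
    labelled : All Labelled (allEdges suns)
    codes-↭  : map edgeCode (allEdges suns) ↭ upTo (9 * width)

open Block

block : (w : ℕ) (ss : List (Sun Point)) →
        {True (all? (narrow? w) ss)} →
        {True (all? labelled? (allEdges ss))} →
        {True (≡-dec _≟_ (sort (map edgeCode (allEdges ss))) (upTo (9 * w)))} →
        Block
block w ss {narrow} {labelled} {sorted} = record
  { width    = w
  ; suns     = ss
  ; narrow   = toWitness narrow
  ; labelled = toWitness labelled
  ; codes-↭  = ↭-trans (↭-sym (sort-↭ _)) (↭-reflexive (toWitness sorted))
  }

block₄ : Block
block₄ = block 4
  ( sun ∞₂ (pt true 3) (pt false 3) (pt true 1) (pt true 4) ∞₃
  ∷ sun ∞₁ (pt false 2) (pt false 3) (pt true 1) ∞₃ (pt false 4)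
  ∷ sun (pt true 2) (pt true 3) ∞₃ ∞₂ ∞₁ (pt false 0)
  ∷ sun (pt false 1) (pt true 1) ∞₃ (pt false 0) (pt true 2) (pt true 0)
  ∷ sun (pt false 0) (pt true 0) ∞₁ ∞₂ (pt true 1) (pt true 2)
  ∷ sun ∞₂ (pt false 1) (pt false 2) (pt true 0) ∞₁ (pt true 2)
  ∷ [])

block₆ : Block
block₆ = block 6
  ( sun (pt true 4) (pt true 5) ∞₁ (pt true 3) (pt true 6) (pt false 3)
  ∷ sun ∞₃ (pt true 5) (pt false 5) (pt true 3) ∞₂ (pt false 6)
  ∷ sun (pt true 4) ∞₂ (pt false 4) ∞₃ (pt true 3) (pt false 3)
  ∷ sun (pt false 5) ∞₁ (pt false 4) ∞₂ (pt true 3) ∞₃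
  ∷ sun ∞₃ (pt false 2) (pt false 3) (pt false 0) ∞₂ (pt true 3)
  ∷ sun ∞₃ (pt true 1) (pt true 2) (pt false 1) ∞₂ (pt true 3)
  ∷ sun ∞₁ (pt true 2) (pt false 2) (pt true 0) ∞₂ (pt false 1)
  ∷ sun (pt false 1) (pt true 1) ∞₁ ∞₂ (pt true 0) (pt false 0)
  ∷ sun (pt false 0) (pt true 0) ∞₂ (pt false 1) ∞₃ (pt false 3)
  ∷ [])

totalWidth : List Block → ℕ
totalWidth [] = 0
totalWidth (B ∷ Bs) = width B + totalWidth Bs

module MöbiusLadder (n : ℕ) (2≤n : 2 ≤ n) where

  u : ℕ
  u = n + n

  0<n : 0 < n
  0<n = <-≤-trans z<s 2≤n

  n<u : n < u
  n<u = m<m+n n 0<n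

  0<u : 0 < u
  0<u = <-trans 0<n n<u

  instance
    u-nonZero : NonZero u
    u-nonZero = >-nonZero 0<u

  Vertex : Set
  Vertex = V u 3

  Dist : ℕ → Set
  Dist d = d ≡ 1 ⊎ d ≡ u / 2

  Adjacent : Vertex → Vertex → Set
  Adjacent = Adj u 3 Dist

  u/2≡n : u / 2 ≡ n
  u/2≡n = trans (cong (_/ 2) (trans (cong (n +_) (sym (+-identityʳ n))) (*-comm 2 n))) (m*n/n≡m n 2)

  ι : ℕ → Fin u
  ι a = fromℕ< (m%n<n a u)

  toℕ-ι : ∀ a → toℕ (ι a) ≡ a % u
  toℕ-ι a = Fin.toℕ-fromℕ< (m%n<n a u)

  toℕ-ι-< : ∀ {a} → a < u → toℕ (ι a) ≡ a
  toℕ-ι-< {a} a<u = trans (toℕ-ι a) (m<n⇒m%n≡m a<u)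

  ι-toℕ : ∀ x → ι (toℕ x) ≡ x
  ι-toℕ x = Fin.toℕ-injective (toℕ-ι-< (Fin.toℕ<n x))

  ι-u : ι u ≡ ι 0
  ι-u = Fin.toℕ-injective (trans (toℕ-ι u) (trans (n%n≡0 u) (sym (toℕ-ι-< 0<u))))

  offset : Bool → ℕ
  offset false = 0
  offset true  = n

  offset-< : ∀ s {j} → j < n → offset s + j < u
  offset-< false j<n = <-trans j<n n<u
  offset-< true  j<n = +-monoʳ-< n j<n

  vertex : Point → Vertex
  vertex (∞ q) = inj₂ q
  vertex (pt s j) = inj₁ (ι (offset s + j))

  vertexPair : Point × Point → Vertex × Vertex
  vertexPair = Product.map vertex vertex

  edge : ℕ → Vertex × Vertex
  edge d = vertexPair (ladderEdge d)

  distZ-self : ∀ x → distZ u x x ≡ 0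
  distZ-self x rewrite ∣n-n∣≡0 (toℕ x) = refl

  distZ-comm : ∀ x y → distZ u x y ≡ distZ u y x
  distZ-comm x y rewrite ∣-∣-comm (toℕ x) (toℕ y) = refl

  ¬Dist0 : ¬ Dist 0
  ¬Dist0 (inj₂ 0≡u/2) = <⇒≢ 0<n (trans 0≡u/2 u/2≡n)

  adjacentℤ : ∀ {x y} → Dist (distZ u x y) → Adjacent (inj₁ x) (inj₁ y)
  adjacentℤ {x} dist = (λ { refl → ¬Dist0 (subst Dist (distZ-self x) dist) }) , dist

  adjacent-sym : ∀ x y → Adjacent x y → Adjacent y x
  adjacent-sym (inj₁ x) (inj₁ y) (x≢y , dist) = x≢y ∘ sym , subst Dist (distZ-comm x y) dist
  adjacent-sym (inj₁ _) (inj₂ _) _ = _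
  adjacent-sym (inj₂ _) (inj₁ _) _ = _

  ∣n-1+n∣≡1 : ∀ a → ∣ a - suc a ∣ ≡ 1
  ∣n-1+n∣≡1 zero = refl
  ∣n-1+n∣≡1 (suc a) = ∣n-1+n∣≡1 a

  distZ-succ : ∀ {a} → a < u → distZ u (ι a) (ι (suc a)) ≡ 1
  distZ-succ {a} a<u rewrite toℕ-ι-< a<u with m≤n⇒m<n∨m≡n a<u
  ... | inj₁ 1+a<u rewrite toℕ-ι-< 1+a<u | ∣n-1+n∣≡1 a =
    m≤n⇒m⊓n≡m (m<n⇒0<n∸m (≤-trans 2≤n (m≤m+n n n)))
  ... | inj₂ 1+a≡u rewrite cong toℕ (trans (cong ι 1+a≡u) ι-u) | toℕ-ι-< 0<u | ∣-∣-identityʳ a =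
    begin
    a ⊓ (u ∸ a)          ≡⟨ cong (λ v → a ⊓ (v ∸ a)) 1+a≡u ⟨
    a ⊓ (suc a ∸ a)      ≡⟨ cong (a ⊓_) (m+n∸n≡m 1 a) ⟩
    a ⊓ 1                ≡⟨ m≥n⇒m⊓n≡n 1≤a ⟩
    1                    ∎
    where
    open ≡-Reasoning
    1≤a : 1 ≤ a
    1≤a = s≤s⁻¹ (≤-trans 2≤n (≤-trans (m≤m+n n n) (≤-reflexive (sym 1+a≡u))))

  distZ-antipodal : ∀ {j} → j < n → distZ u (ι j) (ι (n + j)) ≡ n
  distZ-antipodal {j} j<n rewrite toℕ-ι-< (offset-< false j<n) | toℕ-ι-< (offset-< true j<n) = begin
    ∣ j - n + j ∣ ⊓ (u ∸ ∣ j - n + j ∣)   ≡⟨ cong (λ δ → δ ⊓ (u ∸ δ)) ∣j-n+j∣≡n ⟩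
    n ⊓ (u ∸ n)                         ≡⟨ cong (n ⊓_) (m+n∸m≡n n n) ⟩
    n ⊓ n                               ≡⟨ ⊓-idem n ⟩
    n                                   ∎
    where
    open ≡-Reasoning
    ∣j-n+j∣≡n : ∣ j - n + j ∣ ≡ n
    ∣j-n+j∣≡n = trans (cong₂ ∣_-_∣ (sym (+-identityʳ j)) (+-comm n j))
                      (∣m+n-m+o∣≡∣n-o∣ j 0 n)

  rail-adjacent : ∀ s {j} → j < n → Adjacent (vertex (pt s j)) (vertex (pt s (suc j)))
  rail-adjacent s {j} j<n rewrite +-suc (offset s) j = adjacentℤ (inj₁ (distZ-succ (offset-< s j<n)))

  rung-adjacent : ∀ {j} → j < n → Adjacent (vertex (pt false j)) (vertex (pt true j))
  rung-adjacent j<n = adjacentℤ (inj₂ (trans (distZ-antipodal j<n) (sym u/2≡n)))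

  edgeAt-adjacent : ∀ j k → j < n → uncurry Adjacent (vertexPair (edgeAt j k))
  edgeAt-adjacent j 0 j<n = rail-adjacent false j<n
  edgeAt-adjacent j 1 j<n = rail-adjacent true j<n
  edgeAt-adjacent j 2 j<n = rung-adjacent j<n
  edgeAt-adjacent j 3 _ = _
  edgeAt-adjacent j 4 _ = _
  edgeAt-adjacent j 5 _ = _
  edgeAt-adjacent j 6 _ = _
  edgeAt-adjacent j 7 _ = _
  edgeAt-adjacent j (suc (suc (suc (suc (suc (suc (suc (suc _)))))))) _ = _

  column-< : ∀ {d} → d < 9 * n → d / 9 < n
  column-< {d} d<9n = m<n*o⇒m/o<n (subst (d <_) (*-comm 9 n) d<9n)

  edge-adjacent : ∀ {d} → d < 9 * n → uncurry Adjacent (edge d)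
  edge-adjacent {d} d<9n = edgeAt-adjacent (d / 9) (d % 9) (column-< d<9n)

  orient-adjacent : ∀ {x y d} → d < 9 * n → Orient (x , y) (edge d) → Adjacent x y
  orient-adjacent d<9n (inj₁ refl) = edge-adjacent d<9n
  orient-adjacent d<9n (inj₂ refl) = adjacent-sym _ _ (edge-adjacent d<9n)

  liftℕ : ℕ → Point
  liftℕ a = if does (a <? n) then pt false a else pt true (a ∸ n)

  lift : Vertex → Point
  lift (inj₁ x) = liftℕ (toℕ x)
  lift (inj₂ q) = ∞ q

  index : Vertex → Vertex → ℕ
  index x y = edgeCode (lift x , lift y)

  lift-vertex : ∀ s {j} → j < n → lift (vertex (pt s j)) ≡ pt s j
  lift-vertex false {j} j<n rewrite toℕ-ι-< (offset-< false j<n) | dec-true (j <? n) j<n = refl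
  lift-vertex true  {j} j<n rewrite toℕ-ι-< (offset-< true j<n) | dec-false (n + j <? n) (m+n≮m n j) =
    cong (pt true) (m+n∸m≡n n j)

  lift-vertex-seam : ∀ s → lift (vertex (pt s n)) ≡ pt (not s) 0
  lift-vertex-seam false rewrite toℕ-ι-< n<u | dec-false (n <? n) (n≮n n) = cong (pt true) (n∸n≡0 n)
  lift-vertex-seam true rewrite ι-u | toℕ-ι-< 0<u | dec-true (0 <? n) 0<n = refl

  Indexes : Point × Point → ℕ → Set
  Indexes (a , b) d = index (vertex a) (vertex b) ≡ d × index (vertex b) (vertex a) ≡ d

  index-rail : ∀ s {j} → j < n → Indexes (pt s j , pt s (suc j)) (9 * j + sideCode s)
  index-rail s {j} j<n rewrite lift-vertex s j<n with m≤n⇒m<n∨m≡n j<n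
  ... | inj₁ 1+j<n rewrite lift-vertex s 1+j<n = edgeCode-rail s j , edgeCode-rail′ s j
  ... | inj₂ 1+j≡n rewrite 1+j≡n | lift-vertex-seam s = edgeCode-seam s 0<j , edgeCode-seam′ s 0<j
    where
    0<j : 0 < j
    0<j = s≤s⁻¹ (subst (2 ≤_) (sym 1+j≡n) 2≤n)

  index-rung : ∀ {j} → j < n → Indexes (pt false j , pt true j) (9 * j + 2)
  index-rung {j} j<n rewrite lift-vertex false j<n | lift-vertex true j<n =
    edgeCode-rung j , edgeCode-rung′ j

  index-spoke : ∀ q s {j} → j < n → Indexes (∞ q , pt s j) (9 * j + spokeKind q s)
  index-spoke q s j<n rewrite lift-vertex s j<n = refl , refl

  index-edgeAt : ∀ j k → j < n → k < 9 → Indexes (edgeAt j k) (9 * j + k)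
  index-edgeAt j 0 j<n _ = index-rail false j<n
  index-edgeAt j 1 j<n _ = index-rail true j<n
  index-edgeAt j 2 j<n _ = index-rung j<n
  index-edgeAt j 3 j<n _ = index-spoke zero false j<n
  index-edgeAt j 4 j<n _ = index-spoke zero true j<n
  index-edgeAt j 5 j<n _ = index-spoke (suc zero) false j<n
  index-edgeAt j 6 j<n _ = index-spoke (suc zero) true j<n
  index-edgeAt j 7 j<n _ = index-spoke (suc (suc zero)) false j<n
  index-edgeAt j 8 j<n _ = index-spoke (suc (suc zero)) true j<n
  index-edgeAt j (suc (suc (suc (suc (suc (suc (suc (suc (suc _))))))))) _
    (s≤s (s≤s (s≤s (s≤s (s≤s (s≤s (s≤s (s≤s (s≤s ())))))))))

  index-edge : ∀ {x y d} → d < 9 * n → SameEdge x y (edge d) → index x y ≡ d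
  index-edge {d = d} d<9n same with index-edgeAt (d / 9) (d % 9) (column-< d<9n) (m%n<n d 9) | same
  ... | forward , _ | inj₁ (refl , refl) = trans forward (9*[d/9]+d%9≡d d)
  ... | _ , backward | inj₂ (refl , refl) = trans backward (9*[d/9]+d%9≡d d)

  Covered : Vertex → Vertex → Set
  Covered x y = ∃[ d ] d < 9 * n × SameEdge x y (edge d)

  Coveredℤ : Fin u → Fin u → Set
  Coveredℤ x y = Covered (inj₁ x) (inj₁ y)

  covered-swap : ∀ {x y} → Covered x y → Covered y x
  covered-swap (d , d<9n , same) = d , d<9n , sameEdge-swap same

  covered-by : ∀ {x y} j k → j < n → k < 9 → vertexPair (edgeAt j k) ≡ (x , y) → Covered x y
  covered-by j k j<n k<9 eq = 9 * j + k , code-< , inj₁ (cong proj₁ eq′ , cong proj₂ eq′)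
    where
    eq′ = sym (trans (cong vertexPair (ladderEdge-9*+ j k k<9)) eq)
    code-< : 9 * j + k < 9 * n
    code-< = begin-strict
      9 * j + k   <⟨ +-monoʳ-< (9 * j) k<9 ⟩
      9 * j + 9   ≡⟨ +-comm (9 * j) 9 ⟩
      9 + 9 * j   ≡⟨ *-suc 9 j ⟨
      9 * suc j   ≤⟨ *-monoʳ-≤ 9 j<n ⟩
      9 * n       ∎
      where open ≤-Reasoning

  position : ∀ {a} → a < u → ∃[ s ] ∃[ j ] j < n × offset s + j ≡ a
  position {a} a<u with a <? n
  ... | yes a<n = false , a , a<n , refl
  ... | no a≮n = true , a ∸ n , a∸n<n , m+[n∸m]≡n (≮⇒≥ a≮n)
    where
    a∸n<n : a ∸ n < n
    a∸n<n = subst (a ∸ n <_) (m+n∸m≡n n n) (∸-monoˡ-< a<u (≮⇒≥ a≮n))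

  rail-covered : ∀ {a} → a < u → Covered (inj₁ (ι a)) (inj₁ (ι (suc a)))
  rail-covered a<u with position a<u
  ... | false , j , j<n , refl = covered-by j 0 j<n (s≤s z≤n) refl
  ... | true  , j , j<n , refl =
    covered-by j 1 j<n (s≤s (s≤s z≤n)) (cong (λ m → inj₁ (ι (n + j)) , inj₁ (ι m)) (+-suc n j))

  rung-covered : ∀ {j} → j < n → Covered (inj₁ (ι j)) (inj₁ (ι (n + j)))
  rung-covered j<n = covered-by _ 2 j<n (s≤s (s≤s (s≤s z≤n))) refl

  spoke-covered : ∀ q x → Covered (inj₂ q) (inj₁ x)
  spoke-covered q x with position (Fin.toℕ<n x)
  ... | s , j , j<n , s+j≡x = covered-by j (spokeKind q s) j<n (spokeKind<9 q s)
    (trans (cong vertexPair (edgeAt-spokeKind j q s))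
           (cong (λ m → inj₂ q , inj₁ m) (trans (cong ι s+j≡x) (ι-toℕ x))))

  adjacent-positions : ∀ {a b} → b ≤ a → a < u → Dist ((a ∸ b) ⊓ (u ∸ (a ∸ b))) →
                       a ≡ suc b ⊎ (suc a ≡ u × b ≡ 0) ⊎ a ≡ n + b
  adjacent-positions {a} {b} b≤a a<u = cases (⊓-sel δ (u ∸ δ))
    where
    δ : ℕ
    δ = a ∸ b
    a≡b+δ : a ≡ b + δ
    a≡b+δ = sym (m+[n∸m]≡n b≤a)
    δ≤u : δ ≤ u
    δ≤u = ≤-trans (m∸n≤m a b) (<⇒≤ a<u)
    a≡n+b : δ ≡ n → a ≡ n + b
    a≡n+b δ≡n = trans a≡b+δ (trans (cong (b +_) δ≡n) (+-comm b n))
    wrap : u ∸ δ ≡ 1 → suc a ≡ u × b ≡ 0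
    wrap u∸δ≡1 = 1+a≡u , b≡0
      where
      u≡1+δ : u ≡ suc δ
      u≡1+δ = trans (sym (m∸n+n≡m δ≤u)) (cong (_+ δ) u∸δ≡1)
      b≡0 : b ≡ 0
      b≡0 = n≤0⇒n≡0 (+-cancelʳ-≤ δ b 0 (s≤s⁻¹
              (≤-trans (subst (_≤ u) (cong suc a≡b+δ) a<u) (≤-reflexive u≡1+δ))))
      1+a≡u : suc a ≡ u
      1+a≡u = trans (cong suc (trans a≡b+δ (cong (_+ δ) b≡0))) (sym u≡1+δ)
    cases : δ ⊓ (u ∸ δ) ≡ δ ⊎ δ ⊓ (u ∸ δ) ≡ u ∸ δ → Dist (δ ⊓ (u ∸ δ)) →
            a ≡ suc b ⊎ (suc a ≡ u × b ≡ 0) ⊎ a ≡ n + b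
    cases (inj₁ m) (inj₁ δ≡1) =
      inj₁ (trans a≡b+δ (trans (cong (b +_) (trans (sym m) δ≡1)) (+-comm b 1)))
    cases (inj₁ m) (inj₂ δ≡u/2) = inj₂ (inj₂ (a≡n+b (trans (sym m) (trans δ≡u/2 u/2≡n))))
    cases (inj₂ m) (inj₁ u∸δ≡1) = inj₂ (inj₁ (wrap (trans (sym m) u∸δ≡1)))
    cases (inj₂ m) (inj₂ u∸δ≡u/2) = inj₂ (inj₂ (a≡n+b (trans (sym (m∸[m∸n]≡n δ≤u))
      (trans (cong (u ∸_) (trans (sym m) (trans u∸δ≡u/2 u/2≡n))) (m+n∸m≡n n n)))))

  coveredℤ-≤ : ∀ x y → toℕ y ≤ toℕ x → Dist (distZ u x y) → Covered (inj₁ x) (inj₁ y)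
  coveredℤ-≤ x y b≤a dist
    with adjacent-positions b≤a (Fin.toℕ<n x)
           (subst (λ δ → Dist (δ ⊓ (u ∸ δ))) (m≤n⇒∣n-m∣≡n∸m b≤a) dist)
  ... | inj₁ a≡1+b = subst₂ Coveredℤ (trans (cong ι (sym a≡1+b)) (ι-toℕ x)) (ι-toℕ y)
                       (covered-swap (rail-covered (Fin.toℕ<n y)))
  ... | inj₂ (inj₁ (1+a≡u , b≡0)) =
    subst₂ Coveredℤ (ι-toℕ x) (trans (cong ι 1+a≡u) (trans ι-u (trans (cong ι (sym b≡0)) (ι-toℕ y))))
                    (rail-covered (Fin.toℕ<n x))
  ... | inj₂ (inj₂ a≡n+b) = subst₂ Coveredℤ (trans (cong ι (sym a≡n+b)) (ι-toℕ x)) (ι-toℕ y)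
                       (covered-swap (rung-covered b<n))
    where
    b<n : toℕ y < n
    b<n = +-cancelˡ-< n (toℕ y) n (subst (_< u) a≡n+b (Fin.toℕ<n x))

  adjacent⇒covered : ∀ x y → Adjacent x y → Covered x y
  adjacent⇒covered (inj₁ x) (inj₁ y) (_ , dist) with ≤-total (toℕ y) (toℕ x)
  ... | inj₁ y≤x = coveredℤ-≤ x y y≤x dist
  ... | inj₂ x≤y = covered-swap (coveredℤ-≤ y x x≤y (subst Dist (distZ-comm x y) dist))
  adjacent⇒covered (inj₁ x) (inj₂ q) _ = covered-swap (spoke-covered q x)
  adjacent⇒covered (inj₂ q) (inj₁ x) _ = spoke-covered q x

  residue-cancel : ∀ m {o} → o < u → m % u ≡ (m + o) % u → o ≡ 0
  residue-cancel m {zero} _ _ = refl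
  residue-cancel m {suc o} o<u eq = contradiction eq (m%n≢[m+o]%n m z<s o<u)

  offset-cancel : ∀ s s′ a {o} → o < n →
                  (offset s + a) % u ≡ (offset s′ + (a + o)) % u → s ≡ s′ × o ≡ 0
  offset-cancel false false a o<n eq = refl , residue-cancel a (<-trans o<n n<u) eq
  offset-cancel true true a {o} o<n eq =
    refl , residue-cancel (n + a) (<-trans o<n n<u) (trans eq (cong (_% u) (sym (+-assoc n a o))))
  offset-cancel false true a {o} o<n eq = contradiction (trans eq (cong (_% u) rearranged))
    (m%n≢[m+o]%n a (<-≤-trans 0<n (m≤m+n n o)) (+-monoʳ-< n o<n))
    where
    rearranged : n + (a + o) ≡ a + (n + o)
    rearranged = trans (sym (+-assoc n a o)) (trans (cong (_+ o) (+-comm n a)) (+-assoc a n o))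
  offset-cancel true false a {o} o<n eq = contradiction (trans (sym eq) (cong (_% u) rearranged))
    (m%n≢[m+o]%n (a + o) (m<n⇒0<n∸m o<n) (≤-<-trans (m∸n≤m n o) n<u))
    where
    rearranged : n + a ≡ a + o + (n ∸ o)
    rearranged = trans (+-comm n a)
      (trans (cong (a +_) (sym (m+[n∸m]≡n (<⇒≤ o<n)))) (sym (+-assoc a o (n ∸ o))))

  pt-vertex-injective : ∀ s s′ {j j′} → j ≤ j′ → j′ ∸ j < n →
                        vertex (pt s j) ≡ vertex (pt s′ j′) → pt s j ≡ pt s′ j′
  pt-vertex-injective s s′ {j} {j′} j≤j′ o<n eq = cong₂ pt (proj₁ cancel) j≡j′
    where
    residues : (offset s + j) % u ≡ (offset s′ + (j + (j′ ∸ j))) % u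
    residues = begin
      (offset s + j) % u                 ≡⟨ toℕ-ι (offset s + j) ⟨
      toℕ (ι (offset s + j))             ≡⟨ cong toℕ (Sum.inj₁-injective eq) ⟩
      toℕ (ι (offset s′ + j′))           ≡⟨ toℕ-ι (offset s′ + j′) ⟩
      (offset s′ + j′) % u               ≡⟨ cong (λ m → (offset s′ + m) % u) (m+[n∸m]≡n j≤j′) ⟨
      (offset s′ + (j + (j′ ∸ j))) % u   ∎
      where open ≡-Reasoning
    cancel = offset-cancel s s′ j o<n residues
    j≡j′ : j ≡ j′
    j≡j′ = trans (sym (+-identityʳ j)) (trans (cong (j +_) (sym (proj₂ cancel))) (m+[n∸m]≡n j≤j′))

  vertex-injective : ∀ a b → gap a b < n → vertex a ≡ vertex b → a ≡ b
  vertex-injective (∞ q) (∞ q′) _ eq = cong ∞ (Sum.inj₂-injective eq)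
  vertex-injective (pt s j) (pt s′ j′) gap<n eq with ≤-total j j′
  ... | inj₁ j≤j′ = pt-vertex-injective s s′ j≤j′ (subst (_< n) (m≤n⇒∣m-n∣≡n∸m j≤j′) gap<n) eq
  ... | inj₂ j′≤j =
    sym (pt-vertex-injective s′ s j′≤j (subst (_< n) (m≤n⇒∣n-m∣≡n∸m j′≤j) gap<n) (sym eq))

  placeSun : ℕ → (s : Sun Point) → Narrow n s → Sun Vertex
  placeSun c s narrow = record
    { vtx = vertex ∘ shift c ∘ Sun.vtx s
    ; inj = λ i j eq → Sun.inj s i j (shift-injective c (vertex-injective _ _ (gap< i j) eq))
    }
    where
    gap< : ∀ i j → gap (shift c (Sun.vtx s i)) (shift c (Sun.vtx s j)) < n
    gap< i j = subst (_< n) (sym (gap-shift c (Sun.vtx s i) (Sun.vtx s j))) (narrow i j)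

  placeSuns : ℕ → (ss : List (Sun Point)) → All (Narrow n) ss → List (Sun Vertex)
  placeSuns c [] [] = []
  placeSuns c (s ∷ ss) (narrow ∷ narrows) = placeSun c s narrow ∷ placeSuns c ss narrows

  placeEdge : ℕ → Point × Point → Vertex × Vertex
  placeEdge c = vertexPair ∘ shiftPair c

  allEdges-placeSuns : ∀ c ss narrows → allEdges (placeSuns c ss narrows) ≡ map (placeEdge c) (allEdges ss)
  allEdges-placeSuns c [] [] = refl
  allEdges-placeSuns c (s ∷ ss) (_ ∷ narrows) =
    trans (cong (map (placeEdge c) (Sun.edges s) ++_) (allEdges-placeSuns c ss narrows))
          (sym (map-++ (placeEdge c) (Sun.edges s) (allEdges ss)))

  placeEdge-labelled : ∀ c {e} → Labelled e → Orient (placeEdge c e) (edge (9 * c + edgeCode e))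
  placeEdge-labelled c {e} labelled =
    subst (Orient (placeEdge c e)) (cong vertexPair (shift-ladderEdge c (edgeCode e)))
          (orient-map (vertex ∘ shift c) labelled)

  Fits : Block → Set
  Fits B = width B ≤ n

  layoutSuns : ℕ → (Bs : List Block) → All Fits Bs → List (Sun Vertex)
  layoutSuns c [] [] = []
  layoutSuns c (B ∷ Bs) (fits ∷ fitss) =
    placeSuns c (suns B) (All.map (λ {s} → narrow-≤ fits {s}) (narrow B)) ++ layoutSuns (c + width B) Bs fitss

  layoutCodes : ℕ → List Block → List ℕ
  layoutCodes c [] = []
  layoutCodes c (B ∷ Bs) = map (λ e → 9 * c + edgeCode e) (allEdges (suns B)) ++ layoutCodes (c + width B) Bs

  layout-labelled : ∀ c Bs fitss →
    Pointwise (λ e d → Orient e (edge d)) (allEdges (layoutSuns c Bs fitss)) (layoutCodes c Bs)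
  layout-labelled c [] [] = []
  layout-labelled c (B ∷ Bs) (fits ∷ fitss) =
    subst (λ es → Pointwise _ es (layoutCodes c (B ∷ Bs))) (sym edges≡)
      (Pointwise.++⁺
        (All⇒Pointwise-map (placeEdge c) (λ e → 9 * c + edgeCode e) (placeEdge-labelled c) (labelled B))
        (layout-labelled (c + width B) Bs fitss))
    where
    narrows = All.map (λ {s} → narrow-≤ fits {s}) (narrow B)
    rest = layoutSuns (c + width B) Bs fitss
    edges≡ : allEdges (placeSuns c (suns B) narrows ++ rest) ≡
             map (placeEdge c) (allEdges (suns B)) ++ allEdges rest
    edges≡ = trans (concatMap-++ Sun.edges (placeSuns c (suns B) narrows) rest)
                   (cong (_++ allEdges rest) (allEdges-placeSuns c (suns B) narrows))

  layoutCodes-↭ : ∀ c Bs → layoutCodes c Bs ↭ applyUpTo (9 * c +_) (9 * totalWidth Bs)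
  layoutCodes-↭ c [] = ↭-reflexive refl
  layoutCodes-↭ c (B ∷ Bs) = ↭-trans (Perm.++⁺ block-↭ rest-↭) (↭-reflexive (sym joined))
    where
    w W : ℕ
    w = width B
    W = totalWidth Bs
    block-↭ : map (λ e → 9 * c + edgeCode e) (allEdges (suns B)) ↭ applyUpTo (9 * c +_) (9 * w)
    block-↭ = ↭-trans (↭-reflexive (map-∘ (allEdges (suns B))))
                (↭-trans (Perm.map⁺ (9 * c +_) (codes-↭ B)) (↭-reflexive (map-upTo (9 * c +_) (9 * w))))
    rest-↭ : layoutCodes (c + w) Bs ↭ applyUpTo ((9 * c +_) ∘ (9 * w +_)) (9 * W)
    rest-↭ = ↭-trans (layoutCodes-↭ (c + w) Bs) (↭-reflexive (applyUpTo-cong shifted (9 * W)))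
      where
      shifted : ∀ i → 9 * (c + w) + i ≡ 9 * c + (9 * w + i)
      shifted i = trans (cong (_+ i) (*-distribˡ-+ 9 c w)) (+-assoc (9 * c) (9 * w) i)
    joined : applyUpTo (9 * c +_) (9 * (w + W)) ≡
             applyUpTo (9 * c +_) (9 * w) ++ applyUpTo ((9 * c +_) ∘ (9 * w +_)) (9 * W)
    joined = trans (cong (applyUpTo (9 * c +_)) (*-distribˡ-+ 9 w W)) (applyUpTo-+ (9 * c +_) (9 * w) (9 * W))

  decomposition : (Bs : List Block) → All Fits Bs → totalWidth Bs ≡ n → SunDecomposition u 3 Dist
  decomposition Bs fitss total = record { suns = layoutSuns 0 Bs fitss ; sound = sound ; exactly1 = exactly1 }
    where
    codes : List ℕ
    codes = layoutCodes 0 Bs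
    codes-↭-upTo : codes ↭ upTo (9 * n)
    codes-↭-upTo = subst (λ W → codes ↭ upTo (9 * W)) total (layoutCodes-↭ 0 Bs)
    codes-< : All (_< 9 * n) codes
    codes-< = All.tabulate (∈-upTo⁻ ∘ Perm.∈-resp-↭ codes-↭-upTo)
    labelled-edges = layout-labelled 0 Bs fitss

    sound : ∀ s → s ∈ layoutSuns 0 Bs fitss → ∀ x y → (x , y) ∈ Sun.edges s → Adjacent x y
    sound s s∈ x y xy∈ with Pointwise-∈ labelled-edges (∈-concat⁺′ xy∈ (∈-map⁺ Sun.edges s∈))
    ... | d , d∈ , orient = orient-adjacent (All.lookup codes-< d∈) orient

    exactly1 : ∀ x y → Adjacent x y → countEdge x y (allEdges (layoutSuns 0 Bs fitss)) ≡ 1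
    exactly1 x y adjacent with adjacent⇒covered x y adjacent
    ... | d₀ , d₀<9n , same₀ =
      countEdge-≡1 x y matches labelled-edges codes-< (↭-upTo⇒Unique codes-↭-upTo)
                   (Perm.∈-resp-↭ (↭-sym codes-↭-upTo) (∈-upTo⁺ d₀<9n))
      where
      matches : ∀ {e d} → d < 9 * n → Orient e (edge d) → SameEdge x y e ⇔ d ≡ d₀
      matches d<9n orient = mk⇔
        (λ same → trans (sym (index-edge d<9n (sameEdge-orientʳ orient same))) (index-edge d₀<9n same₀))
        (λ { refl → sameEdge-orientˡ orient same₀ })

Tiling : ℕ → Set
Tiling n = ∃[ Bs ] All (λ B → width B ≤ n) Bs × totalWidth Bs ≡ n

tiling : ∀ w → 2 ≤ w → Tiling (w + w)
tiling 1 (s≤s ())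
tiling 2 _ = block₄ ∷ [] , ≤-refl ∷ [] , refl
tiling 3 _ = block₆ ∷ [] , ≤-refl ∷ [] , refl
tiling (suc (suc w@(suc (suc _)))) _ with tiling w (s≤s (s≤s z≤n))
... | Bs , fits , total = block₄ ∷ Bs , 4≤ ∷ All.map (λ le → ≤-trans le w+w≤) fits , total′
  where
  4≤ : 4 ≤ suc (suc w) + suc (suc w)
  4≤ = s≤s (s≤s (≤-trans (s≤s (s≤s z≤n)) (m≤n+m (suc (suc w)) w)))
  w+w≤ : w + w ≤ suc (suc w) + suc (suc w)
  w+w≤ = +-mono-≤ (≤-trans (n≤1+n w) (n≤1+n (suc w))) (≤-trans (n≤1+n w) (n≤1+n (suc w)))
  total′ : 4 + totalWidth Bs ≡ suc (suc w) + suc (suc w)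
  total′ = trans (cong (4 +_) total) (cong (2 +_) (sym (trans (+-suc w (suc w)) (cong suc (+-suc w w)))))

w*4≡[w+w]+[w+w] : ∀ w → w * 4 ≡ (w + w) + (w + w)
w*4≡[w+w]+[w+w] = solve-∀

admissibleResidues : List ℕ
admissibleResidues = 0 ∷ 1 ∷ 3 ∷ 4 ∷ 5 ∷ 7 ∷ 8 ∷ 9 ∷ 11 ∷ []

even-admissible⇒4∣ : All (λ r → r % 2 ≡ 0 → 4 ∣ r) admissibleResidues
even-admissible⇒4∣ = from-yes (all? (λ r → (r % 2 ≟ 0) →-dec (4 ∣? r)) admissibleResidues)

4∣u : ∀ u → 2 ∣ u → u % 12 ∈ admissibleResidues → 4 ∣ u
4∣u u 2∣u u%12∈ = subst (4 ∣_) (sym (m≡m%n+[m/n]*n u 12))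
  (∣m∣n⇒∣m+n (All.lookup even-admissible⇒4∣ u%12∈ u%12%2≡0)
              (∣-trans (divides 3 refl) (n∣m*n (u / 12))))
  where
  u%12%2≡0 : u % 12 % 2 ≡ 0
  u%12%2≡0 = trans (m∣n⇒o%n%m≡o%m 2 12 u (divides 6 refl)) (n∣m⇒m%n≡0 u 2 2∣u)

lemma2p5 : (u : ℕ) → 2 ∣ u → u ≥ 8
    → u % 12 ∈ (0 ∷ 1 ∷ 3 ∷ 4 ∷ 5 ∷ 7 ∷ 8 ∷ 9 ∷ 11 ∷ [])
    → SunDecomposition u 3 (λ d → d ≡ 1 ⊎ d ≡ u / 2)
lemma2p5 u 2∣u 8≤u u%12∈ with 4∣u u 2∣u u%12∈
... | divides w u≡w*4 =
  let Bs , fits , total = tiling w 2≤w in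
  subst (λ v → SunDecomposition v 3 (λ d → d ≡ 1 ⊎ d ≡ v / 2)) (sym u≡4w)
        (MöbiusLadder.decomposition (w + w) (≤-trans 2≤w (m≤m+n w w)) Bs fits total)
  where
  u≡4w : u ≡ (w + w) + (w + w)
  u≡4w = trans u≡w*4 (w*4≡[w+w]+[w+w] w)
  2≤w : 2 ≤ w
  2≤w = *-cancelʳ-≤ 2 w 4 (subst (8 ≤_) u≡w*4 8≤u)
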